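{- Let $h$ and $t$ be integers with $2 \leq t < \log h / \log 2$. Then there exists a partition $\mathbb{N} = W_0 \cup W_1 \cup \dots \cup W_{h-1}$ of $\mathbb{N}$ into pairwise disjoint sets such that each set $W_i$ ($0 \le i \le h-1$) is a union of infinitely many intervals, each consisting of at least $t$ consecutive integers, and such that every sufficiently large integer $n$ can be written as $n = a_1 + \dots + a_h$ with $a_1, \dots, a_h \in A(W_0)$ (not necessarily distinct).
   Context: $\mathbb{N}$ denotes the set of all nonnegative integers. For a nonempty subset $W \subseteq \mathbb{N}$, $A(W)$ denotes the set of all integers of the form $\sum_{f \in F} 2^f$, where $F$ ranges over all finite nonempty subsets of $W$. -}

module Defs where

open import Data.Nat using (ℕ; zero; suc; _+_; _^_; _≤_; _<_)
open import Data.List using (List; []; _∷_; map)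
open import Data.Nat.ListAction using (sum)
open import Data.List.Relation.Unary.All using (All)
open import Data.List.Relation.Unary.Unique.Propositional using (Unique)
open import Data.Vec using (Vec)
import Data.Vec as Vec
import Data.Vec.Relation.Unary.All as VecAll
open import Data.Product using (Σ; ∃; _×_)
open import Relation.Binary.PropositionalEquality using (_≡_; _≢_)

-- m ∈ A(W): m = Σ_{f ∈ F} 2^f for some finite nonempty F ⊆ W.
-- A finite set F is represented by a duplicate-free list.
InA : (ℕ → Set) → ℕ → Set
InA W m = Σ (List ℕ) λ F →
  (F ≢ []) × Unique F × All W F × (m ≡ sum (map (2 ^_) F))

-- W is a union of infinitely many intervals, each consisting of at least
-- t consecutive integers: there are intervals [s k, s k + ℓ k) (k ∈ ℕ)
-- with strictly increasing left endpoints (hence infinitely many distinct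
-- intervals), each of length ℓ k ≥ t, whose union is exactly W.
UnionOfInfinitelyManyIntervals : ℕ → (ℕ → Set) → Set
UnionOfInfinitelyManyIntervals t W =
  Σ (ℕ → ℕ) λ s → Σ (ℕ → ℕ) λ ℓ →
    (∀ k → s k < s (suc k)) ×
    (∀ k → t ≤ ℓ k) ×
    (∀ n → (W n → ∃ λ k → s k ≤ n × n < s k + ℓ k)
         × ((∃ λ k → s k ≤ n × n < s k + ℓ k) → W n))

EventuallySumOf : ℕ → (ℕ → Set) → Set
EventuallySumOf h W =
  ∃ λ N → ∀ n → N ≤ n →
    Σ (Vec ℕ h) λ a → VecAll.All (InA W) a × (n ≡ Vec.sum a)

{-# OPTIONS --safe #-}
module Submission where

-- Cut ℕ into periods of length P = 2t + 2. In every period the first L = t + 2 positions get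
-- colour 0 and the last t positions get colour 1 + (index of the period mod (h − 1)).
-- A number whose base-2 ^ P digits are all below 2 ^ L has all its binary digits in W₀, so
-- lies in A(W₀) unless it is 0. Since h > 2 ^ t, every base-2 ^ P digit of n − h splits into
-- h parts of size at most 2 ^ L − 2; this writes n − h as a sum of h numbers with such digits,
-- and adding 1 to each summand gives h nonzero summands whose digits are still below 2 ^ L.

open import Defs
open import Data.Nat using (ℕ; _^_; _≤_; _<_)
open import Data.Product using (Σ; _×_)
open import Relation.Binary.PropositionalEquality using (_≡_)

open import Data.Nat
open import Data.Nat.Properties
open import Data.Nat.DivMod
open import Data.Nat.Induction using (<-rec)
open import Data.Nat.ListAction using (sum)
open import Data.Nat.ListAction.Properties using (sum-++)
open import Data.Nat.Tactic.RingSolver using (solve-∀)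
open import Data.Empty using (⊥-elim)
open import Data.Product using (∃; _,_; proj₂)
open import Data.Sum using (inj₁; inj₂; [_,_])
open import Data.List using (List; []; _∷_; map; _++_)
open import Data.List.Properties using (map-++)
open import Data.List.Relation.Binary.Disjoint.Propositional using (Disjoint)
open import Data.List.Relation.Unary.All as All using (All; []; _∷_)
import Data.List.Relation.Unary.All.Properties as Allₚ
open import Data.List.Relation.Unary.AllPairs using ([]; _∷_)
open import Data.List.Relation.Unary.Unique.Propositional using (Unique)
import Data.List.Relation.Unary.Unique.Propositional.Properties as Uniqueₚ
open import Data.Vec using (Vec; []; _∷_)
import Data.Vec as Vec
open import Data.Vec.Relation.Unary.All as VecAll using ([]; _∷_)
open import Algebra.Properties.CommutativeSemigroup +-commutativeSemigroup
  using (x∙yz≈y∙xz; xy∙z≈xz∙y)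
open import Function.Bundles using (_⇔_; mk⇔; Equivalence)
open import Relation.Nullary using (¬_; yes; no)
open import Relation.Unary using (_⊆_; _∪_)
open import Relation.Binary.PropositionalEquality using (_≢_; refl; sym; trans; cong; cong₂; subst; module ≡-Reasoning)

powSum : List ℕ → ℕ
powSum F = sum (map (2 ^_) F)

DistinctPowerSum : (ℕ → Set) → ℕ → Set
DistinctPowerSum Q x = Σ (List ℕ) λ F → Unique F × All Q F × x ≡ powSum F

powSum-++ : ∀ F G → powSum (F ++ G) ≡ powSum F + powSum G
powSum-++ F G = trans (cong sum (map-++ (2 ^_) F G)) (sum-++ (map (2 ^_) F) (map (2 ^_) G))

powSum-shift : ∀ k F → powSum (map (k +_) F) ≡ 2 ^ k * powSum F
powSum-shift k [] = sym (*-zeroʳ (2 ^ k))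
powSum-shift k (f ∷ F) = begin
  2 ^ (k + f) + powSum (map (k +_) F)  ≡⟨ cong₂ _+_ (^-distribˡ-+-* 2 k f) (powSum-shift k F) ⟩
  2 ^ k * 2 ^ f + 2 ^ k * powSum F     ≡⟨ *-distribˡ-+ (2 ^ k) (2 ^ f) (powSum F) ⟨
  2 ^ k * powSum (f ∷ F)               ∎
  where open ≡-Reasoning

module _ {Q R : ℕ → Set} where

  DistinctPowerSum-mono : Q ⊆ R → DistinctPowerSum Q ⊆ DistinctPowerSum R
  DistinctPowerSum-mono Q⊆R (F , u , q , e) = F , u , All.map Q⊆R q , e

  DistinctPowerSum-+ : ∀ {x y} → (∀ {f} → Q f → ¬ R f) →
    DistinctPowerSum Q x → DistinctPowerSum R y → DistinctPowerSum (Q ∪ R) (x + y)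
  DistinctPowerSum-+ Q⊥R (F , uF , qF , refl) (G , uG , rG , refl) =
    F ++ G , Uniqueₚ.++⁺ uF uG disjoint , Allₚ.++⁺ (All.map inj₁ qF) (All.map inj₂ rG) ,
    sym (powSum-++ F G)
    where
    disjoint : Disjoint F G
    disjoint (f∈F , f∈G) = Q⊥R (All.lookup qF f∈F) (All.lookup rG f∈G)

  DistinctPowerSum-*2^ : ∀ k {y} → (∀ {f} → Q f → R (k + f)) →
    DistinctPowerSum Q y → DistinctPowerSum R (2 ^ k * y)
  DistinctPowerSum-*2^ k shift (F , u , q , refl) =
    map (k +_) F , Uniqueₚ.map⁺ (+-cancelˡ-≡ k _ _) u , Allₚ.map⁺ (All.map shift q) ,
    sym (powSum-shift k F)

binaryExpansion : ∀ f {x} → x < 2 ^ f → DistinctPowerSum (_< f) x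
binaryExpansion zero {zero} _ = [] , [] , [] , refl
binaryExpansion zero {suc _} (s≤s ())
binaryExpansion (suc f) {x} x<2^[1+f] with x <? 2 ^ f
... | yes x<2^f = DistinctPowerSum-mono m<n⇒m<1+n (binaryExpansion f x<2^f)
... | no x≮2^f = withTopBit (binaryExpansion f rest<2^f)
  where
  rest<2^f : x ∸ 2 ^ f < 2 ^ f
  rest<2^f = m<n+o⇒m∸n<o x (2 ^ f) {{m^n≢0 2 f}}
    (subst (x <_) (cong (2 ^ f +_) (+-identityʳ (2 ^ f))) x<2^[1+f])
  withTopBit : DistinctPowerSum (_< f) (x ∸ 2 ^ f) → DistinctPowerSum (_< suc f) x
  withTopBit (F , u , F<f , e) =
    f ∷ F , All.map >⇒≢ F<f ∷ u , n<1+n f ∷ All.map m<n⇒m<1+n F<f ,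
    trans (sym (m+[n∸m]≡n (≮⇒≥ x≮2^f))) (cong (2 ^ f +_) e)

DistinctPowerSum⇒InA : ∀ {Q x} → DistinctPowerSum Q (suc x) → InA Q (suc x)
DistinctPowerSum⇒InA (F , u , q , e) = F , F≢[] , u , q , e
  where
  F≢[] : F ≢ []
  F≢[] F≡[] = 1+n≢0 (trans e (cong powSum F≡[]))

InA-mono : ∀ {Q R} → Q ⊆ R → InA Q ⊆ InA R
InA-mono Q⊆R (F , F≢[] , u , q , e) = F , F≢[] , u , All.map Q⊆R q , e

SumOf : ℕ → (ℕ → Set) → ℕ → Set
SumOf h Q n = Σ (Vec ℕ h) λ a → VecAll.All Q a × n ≡ Vec.sum a

EventuallySumOf-mono : ∀ {h Q R} → Q ⊆ R → EventuallySumOf h Q → EventuallySumOf h R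
EventuallySumOf-mono Q⊆R (N , sums) = N , λ n N≤n →
  let a , inA , e = sums n N≤n in a , VecAll.map (InA-mono Q⊆R) inA , e

SumOf-suc : ∀ {h n Q R} → (∀ {x} → Q x → R (suc x)) → SumOf h Q n → SumOf h R (h + n)
SumOf-suc f ([] , [] , refl) = [] , [] , refl
SumOf-suc {suc h} f (x ∷ a , qx ∷ qa , refl) =
  let b , rb , e = SumOf-suc f (a , qa , refl) in
  suc x ∷ b , f qx ∷ rb , cong suc (trans (x∙yz≈y∙xz h x (Vec.sum a)) (cong (x +_) e))

splitBounded : ∀ m {c} v → v ≤ m * c → SumOf m (_≤ c) v
splitBounded zero v v≤0 = [] , [] , n≤0⇒n≡0 v≤0
splitBounded (suc m) {c} v v≤c+mc with v ≤? c
... | yes v≤c =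
  let a , a≤c , 0≡Σa = splitBounded m 0 z≤n in
  v ∷ a , v≤c ∷ a≤c , trans (sym (+-identityʳ v)) (cong (v +_) 0≡Σa)
... | no v≰c =
  let a , a≤c , e = splitBounded m (v ∸ c) (m≤n+o⇒m∸n≤o v c v≤c+mc) in
  c ∷ a , ≤-refl ∷ a≤c , trans (sym (m+[n∸m]≡n (<⇒≤ (≰⇒> v≰c)))) (cong (c +_) e)

data BoundedDigits (K c : ℕ) : ℕ → Set where
  [] : BoundedDigits K c 0
  _∷_ : ∀ {x y} → x ≤ c → BoundedDigits K c y → BoundedDigits K c (x + y * K)

BoundedDigits-mono : ∀ {K c d} → c ≤ d → BoundedDigits K c ⊆ BoundedDigits K d
BoundedDigits-mono c≤d [] = []
BoundedDigits-mono c≤d (x≤c ∷ ds) = ≤-trans x≤c c≤d ∷ BoundedDigits-mono c≤d ds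

BoundedDigits-suc : ∀ {K c n} → BoundedDigits K c n → BoundedDigits K (suc c) (suc n)
BoundedDigits-suc [] = s≤s z≤n ∷ []
BoundedDigits-suc {c = c} (x≤c ∷ ds) = s≤s x≤c ∷ BoundedDigits-mono (n≤1+n c) ds

module _ {K c : ℕ} where

  noDigits : ∀ h → SumOf h (BoundedDigits K c) 0
  noDigits zero = [] , [] , refl
  noDigits (suc h) = let a , ds , e = noDigits h in 0 ∷ a , [] ∷ ds , e

  prependDigits : ∀ {h x y} → SumOf h (_≤ c) x → SumOf h (BoundedDigits K c) y →
    SumOf h (BoundedDigits K c) (x + y * K)
  prependDigits ([] , [] , refl) ([] , [] , refl) = [] , [] , refl
  prependDigits (d ∷ a , d≤c ∷ a≤c , refl) (e ∷ b , ds ∷ dss , refl) =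
    let ab , dsab , eq = prependDigits (a , a≤c , refl) (b , dss , refl) in
    d + e * K ∷ ab , (d≤c ∷ ds) ∷ dsab ,
    trans (interchange d e (Vec.sum a) (Vec.sum b) K) (cong (d + e * K +_) eq)
    where
    interchange : ∀ d e s t K → d + s + (e + t) * K ≡ d + e * K + (s + t * K)
    interchange = solve-∀

  boundedDigitsSum : ∀ h .{{_ : NonZero K}} → 1 < K → K ≤ suc (h * c) →
    ∀ n → SumOf h (BoundedDigits K c) n
  boundedDigitsSum h 1<K K≤1+hc = <-rec _ expand
    where
    expand : ∀ n → (∀ {m} → m < n → SumOf h (BoundedDigits K c) m) →
             SumOf h (BoundedDigits K c) n
    expand zero _ = noDigits h
    expand n@(suc _) expandBelow =
      subst (SumOf h (BoundedDigits K c)) (sym (m≡m%n+[m/n]*n n K))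
        (prependDigits (splitBounded h (n % K) (s≤s⁻¹ (≤-trans (m%n<n n K) K≤1+hc)))
                       (expandBelow (m/n<m n K 1<K)))

InBlocks : ℕ → ℕ → ℕ → Set
InBlocks P L f = ∃ λ k → k * P ≤ f × f < k * P + L

boundedDigits⇒DistinctPowerSum : ∀ {P L c} → L ≤ P → c < 2 ^ L →
  BoundedDigits (2 ^ P) c ⊆ DistinctPowerSum (InBlocks P L)
boundedDigits⇒DistinctPowerSum L≤P c<2^L [] = [] , [] , [] , refl
boundedDigits⇒DistinctPowerSum {P} {L} L≤P c<2^L (_∷_ {x} {y} x≤c ds) =
  subst (DistinctPowerSum (InBlocks P L)) (cong (x +_) (*-comm (2 ^ P) y))
    (DistinctPowerSum-mono [ inFirstBlock , proj₂ ]
      (DistinctPowerSum-+ lowBits≠highBits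
        (binaryExpansion L (≤-<-trans x≤c c<2^L))
        (DistinctPowerSum-*2^ P shiftBlock (boundedDigits⇒DistinctPowerSum L≤P c<2^L ds))))
  where
  inFirstBlock : ∀ {f} → f < L → InBlocks P L f
  inFirstBlock f<L = 0 , z≤n , f<L
  shiftBlock : ∀ {f} → InBlocks P L f → P ≤ P + f × InBlocks P L (P + f)
  shiftBlock {f} (k , kP≤f , f<kP+L) =
    m≤m+n P f , suc k , +-monoʳ-≤ P kP≤f ,
    ≤-trans (+-monoʳ-< P f<kP+L) (≤-reflexive (sym (+-assoc P (k * P) L)))
  lowBits≠highBits : ∀ {f} → f < L → ¬ (P ≤ f × InBlocks P L f)
  lowBits≠highBits f<L (P≤f , _) = <⇒≱ (<-≤-trans f<L L≤P) P≤f

eventuallySumOfBlocks : ∀ h {P L c} → L ≤ P → suc c < 2 ^ L → 2 ^ P ≤ suc (h * c) →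
  EventuallySumOf h (InBlocks P L)
eventuallySumOfBlocks h {P} {L} {c} L≤P 1+c<2^L 2^P≤1+hc = h , λ n h≤n →
  subst (SumOf h (InA (InBlocks P L))) (m+[n∸m]≡n h≤n)
    (SumOf-suc (λ ds → DistinctPowerSum⇒InA
                  (boundedDigits⇒DistinctPowerSum L≤P 1+c<2^L (BoundedDigits-suc ds)))
      (boundedDigitsSum h {{m^n≢0 2 P}} 1<2^P 2^P≤1+hc (n ∸ h)))
  where
  1<2^P : 1 < 2 ^ P
  1<2^P = <-≤-trans (≤-<-trans (s≤s z≤n) 1+c<2^L) (^-monoʳ-≤ 2 L≤P)

module _ {P : ℕ} .{{_ : NonZero P}} where

  divMod-unique : ∀ q {r} → r < P → (r + q * P) / P ≡ q × (r + q * P) % P ≡ r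
  divMod-unique q {r} r<P = quotient , remainder
    where
    n : ℕ
    n = r + q * P
    remainder : n % P ≡ r
    remainder = trans ([m+kn]%n≡m%n r q P) (m<n⇒m%n≡m r<P)
    quotient : n / P ≡ q
    quotient = *-cancelʳ-≡ (n / P) q P (+-cancelˡ-≡ r _ _ (begin
      r + n / P * P      ≡⟨ cong (_+ n / P * P) remainder ⟨
      n % P + n / P * P  ≡⟨ m≡m%n+[m/n]*n n P ⟨
      n                  ∎))
      where open ≡-Reasoning

  ∈-block⇔ : ∀ {n} q a d → a + d ≤ P →
    (a + q * P ≤ n × n < a + q * P + d) ⇔ (n / P ≡ q × a ≤ n % P × n % P < a + d)
  ∈-block⇔ q a d a+d≤P = mk⇔ to from
    where
    to : ∀ {n} → a + q * P ≤ n × n < a + q * P + d → n / P ≡ q × a ≤ n % P × n % P < a + d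
    to {n} (lo , hi) with n ∸ q * P | m∸n+n≡m (≤-trans (m≤n+m (q * P) a) lo)
    ... | r | refl =
      let quotient , remainder = divMod-unique q (<-≤-trans r<a+d a+d≤P) in
      quotient , subst (a ≤_) (sym remainder) a≤r , subst (_< a + d) (sym remainder) r<a+d
      where
      a≤r : a ≤ r
      a≤r = +-cancelʳ-≤ (q * P) a r lo
      r<a+d : r < a + d
      r<a+d = +-cancelʳ-< (q * P) r (a + d) (subst (r + q * P <_) (xy∙z≈xz∙y a (q * P) d) hi)
    from : ∀ {n} → n / P ≡ q × a ≤ n % P × n % P < a + d → a + q * P ≤ n × n < a + q * P + d
    from {n} (n/P≡q , a≤r , r<a+d) =
      subst (λ m → a + q * P ≤ m × m < a + q * P + d) (sym n≡r+qP)
        (+-monoˡ-≤ (q * P) a≤r ,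
         subst (n % P + q * P <_) (sym (xy∙z≈xz∙y a (q * P) d)) (+-monoˡ-< (q * P) r<a+d))
      where
      n≡r+qP : n ≡ n % P + q * P
      n≡r+qP = trans (m≡m%n+[m/n]*n n P) (cong (λ k → n % P + k * P) n/P≡q)

UnionOfInfinitelyManyIntervals-weaken : ∀ {t u W} → t ≤ u →
  UnionOfInfinitelyManyIntervals u W → UnionOfInfinitelyManyIntervals t W
UnionOfInfinitelyManyIntervals-weaken t≤u (s , ℓ , s-inc , u≤ℓ , W⇔) =
  s , ℓ , s-inc , (λ k → ≤-trans t≤u (u≤ℓ k)) , W⇔

module Colouring (L t H : ℕ) .{{_ : NonZero (L + t)}} .{{_ : NonZero H}} where

  P : ℕ
  P = L + t

  colour : ℕ → ℕ
  colour n with n % P <? L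
  ... | yes _ = 0
  ... | no _ = suc (n / P % H)

  colour<1+H : ∀ n → colour n < suc H
  colour<1+H n with n % P <? L
  ... | yes _ = z<s
  ... | no _ = s≤s (m%n<n (n / P) H)

  colour≡0⇔ : ∀ {n} → colour n ≡ 0 ⇔ n % P < L
  colour≡0⇔ {n} with n % P <? L
  ... | yes r<L = mk⇔ (λ _ → r<L) (λ _ → refl)
  ... | no r≮L = mk⇔ (λ ()) (λ r<L → ⊥-elim (r≮L r<L))

  colour≡suc⇔ : ∀ {n j} → colour n ≡ suc j ⇔ (L ≤ n % P × n / P % H ≡ j)
  colour≡suc⇔ {n} with n % P <? L
  ... | yes r<L = mk⇔ (λ ()) (λ (L≤r , _) → ⊥-elim (<⇒≱ r<L L≤r))
  ... | no r≮L = mk⇔ (λ e → ≮⇒≥ r≮L , suc-injective e) (λ (_ , e) → cong suc e)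

  colour≡0⇔InBlocks : ∀ {n} → colour n ≡ 0 ⇔ InBlocks P L n
  colour≡0⇔InBlocks {n} = mk⇔
    (λ c≡0 → n / P ,
      Equivalence.from (∈-block⇔ (n / P) 0 L L≤P) (refl , z≤n , Equivalence.to colour≡0⇔ c≡0))
    (λ (k , inBlock) → Equivalence.from colour≡0⇔
      (proj₂ (proj₂ (Equivalence.to (∈-block⇔ k 0 L L≤P) inBlock))))
    where
    L≤P : L ≤ P
    L≤P = m≤m+n L t

  colour≡0-intervals : UnionOfInfinitelyManyIntervals L (λ n → colour n ≡ 0)
  colour≡0-intervals =
    (λ k → k * P) , (λ _ → L) , (λ k → *-monoˡ-< P (n<1+n k)) , (λ _ → ≤-refl) ,
    λ n → Equivalence.to colour≡0⇔InBlocks , Equivalence.from colour≡0⇔InBlocks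

  colour≡suc-intervals : ∀ {j} → j < H → UnionOfInfinitelyManyIntervals t (λ n → colour n ≡ suc j)
  colour≡suc-intervals {j} j<H = start , (λ _ → t) , start-inc , (λ _ → ≤-refl) , λ n → to , from
    where
    start : ℕ → ℕ
    start k = L + (j + k * H) * P
    start-inc : ∀ k → start k < start (suc k)
    start-inc k = +-monoʳ-< L (*-monoˡ-< P (+-monoʳ-< j (m<n+m (k * H) (>-nonZero⁻¹ H))))
    to : ∀ {n} → colour n ≡ suc j → ∃ λ k → start k ≤ n × n < start k + t
    to {n} c≡1+j =
      let L≤r , q%H≡j = Equivalence.to colour≡suc⇔ c≡1+j
          q≡j+kH = trans (m≡m%n+[m/n]*n (n / P) H) (cong (_+ n / P / H * H) q%H≡j)
      in n / P / H ,
         Equivalence.from (∈-block⇔ (j + n / P / H * H) L t ≤-refl) (q≡j+kH , L≤r , m%n<n n P)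
    from : ∀ {n} → (∃ λ k → start k ≤ n × n < start k + t) → colour n ≡ suc j
    from {n} (k , inBlock) =
      let q≡j+kH , L≤r , _ = Equivalence.to (∈-block⇔ (j + k * H) L t ≤-refl) inBlock
      in Equivalence.from colour≡suc⇔
           (L≤r , trans (cong (_% H) q≡j+kH) (trans ([m+kn]%n≡m%n j k H) (m<n⇒m%n≡m j<H)))

-- c bounds the base-2 ^ (2 + t + t) digits of a summand before its final +1: c + 1 still
-- fits into the 2 + t low bits of a period, and h * c is large enough for every digit to
-- split into h parts of size ≤ c.
digitBudget : ∀ t {h} → 2 ^ t < h → Σ ℕ λ c → suc c < 2 ^ (2 + t) × 2 ^ (2 + t + t) ≤ h * c
digitBudget t {h} 2^t<h rewrite ^-distribˡ-+-* 2 t t with 2 ^ t | m^n>0 2 t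
... | suc b | _ = 2 + 4 * b , ≤-reflexive (digitIdentity b) , (begin
  2 * (2 * (suc b * suc b))          ≤⟨ m≤m+n _ (2 * b) ⟩
  2 * (2 * (suc b * suc b)) + 2 * b  ≡⟨ squareIdentity b ⟩
  (2 + b) * (2 + 4 * b)              ≤⟨ *-monoˡ-≤ (2 + 4 * b) 2^t<h ⟩
  h * (2 + 4 * b)                    ∎)
  where
  open ≤-Reasoning
  digitIdentity : ∀ b → 4 + 4 * b ≡ 2 * (2 * suc b)
  digitIdentity = solve-∀
  squareIdentity : ∀ b → 2 * (2 * (suc b * suc b)) + 2 * b ≡ (2 + b) * (2 + 4 * b)
  squareIdentity = solve-∀

mainTheorem2 : (h t : ℕ) → 2 ≤ t → 2 ^ t < h →
    Σ (ℕ → ℕ) λ W →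
      (∀ n → W n < h) ×
      (∀ i → i < h → UnionOfInfinitelyManyIntervals t (λ n → W n ≡ i)) ×
      EventuallySumOf h (λ n → W n ≡ 0)
mainTheorem2 zero t _ ()
mainTheorem2 (suc zero) t _ 2^t<1 = ⊥-elim (<⇒≱ 2^t<1 (m^n>0 2 t))
mainTheorem2 h@(suc (suc H)) t _ 2^t<h with digitBudget t 2^t<h
... | _ , 1+c<2^L , 2^P≤hc =
  colour , colour<1+H , intervals ,
  EventuallySumOf-mono (Equivalence.from colour≡0⇔InBlocks)
    (eventuallySumOfBlocks h (m≤m+n (2 + t) t) 1+c<2^L (m≤n⇒m≤1+n 2^P≤hc))
  where
  open Colouring (2 + t) t (suc H)
  intervals : ∀ i → i < h → UnionOfInfinitelyManyIntervals t (λ n → colour n ≡ i)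
  intervals zero _ = UnionOfInfinitelyManyIntervals-weaken (m≤n+m t 2) colour≡0-intervals
  intervals (suc j) 1+j<h = colour≡suc-intervals (s≤s⁻¹ 1+j<h)
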